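{- $\Delta_{\mathrm{Gon}}(\mathcal B_{2,3})\subseteq\mathbb Q\langle X\rangle\otimes\mathcal B_{2,3}$.
   Context: Let $X=\{x_0,x_1\}$ and let $\mathbb Q\langle X\rangle$ be the free non-commutative $\mathbb Q$-algebra on $X$, with word basis and empty word $\mathbf 1$. Write $(f\mid w)$ for coefficients. $\mathcal B_{2,3}=\mathbb Q\langle x_0x_1,x_0x_0x_1\rangle\subset\mathbb Q\langle X\rangle$ is the span of all words that are concatenations of the blocks $x_0x_1$ and $x_0x_0x_1$, including $\mathbf 1$. The shuffle product is defined by $\mathbf 1\sqcup\!\sqcup w=w\sqcup\!\sqcup\mathbf 1=w$ and $au\sqcup\!\sqcup bv=a(u\sqcup\!\sqcup bv)+b(au\sqcup\!\sqcup v)$. Let $S(\varepsilon_1\cdots\varepsilon_n)=(-1)^n\varepsilon_n\cdots\varepsilon_1$. Set $I(a;f;b)=f$ if $(a,b)=(x_1,x_0)$, $S(f)$ if $(a,b)=(x_0,x_1)$, and $(f\mid\mathbf 1)\mathbf 1$ if $a=b$. The Goncharov coproduct is defined on words, with $\varepsilon_0=x_1$ and $\varepsilon_{n+1}=x_0$, by $$\Delta_{\mathrm{Gon}}(\varepsilon_1\cdots\varepsilon_n)=\sum_{k=0}^n\sum_{0=i_0<i_1<\dots<i_k<i_{k+1}=n+1}\Big(\mathop{\sqcup\!\sqcup}_{p=0}^k I(\varepsilon_{i_p};\varepsilon_{i_p+1}\cdots\varepsilon_{i_{p+1}-1};\varepsilon_{i_{p+1}})\Big)\otimes\varepsilon_{i_1}\cdots\varepsilon_{i_k},$$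 extended linearly. -}

module Defs where

open import Data.Rational using (ℚ; 0ℚ; 1ℚ; _+_; _*_; -_)
open import Data.List using (List; []; _∷_; _++_; [_]; map; concatMap; reverse; length; foldr)
open import Data.Product using (_×_; _,_)
open import Data.Nat using (ℕ; zero; suc)
open import Relation.Nullary using (yes; no; ¬_)
open import Relation.Binary.PropositionalEquality using (_≡_; refl)
open import Relation.Binary.Definitions using (DecidableEquality)
import Data.List.Properties as LP

data Letter : Set where
  x₀ x₁ : Letter

_≟L_ : DecidableEquality Letter
x₀ ≟L x₀ = yes refl
x₀ ≟L x₁ = no (λ ())
x₁ ≟L x₀ = no (λ ())
x₁ ≟L x₁ = yes refl

Word : Set
Word = List Letter

_≟W_ : DecidableEquality Word
_≟W_ = LP.≡-dec _≟L_

-- Elements of ℚ⟨X⟩ as finite formal linear combinations of words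
Poly : Set
Poly = List (ℚ × Word)

-- Elements of ℚ⟨X⟩ ⊗ ℚ⟨X⟩ as finite formal linear combinations of u ⊗ v
Tensor : Set
Tensor = List (ℚ × Word × Word)

coeff : Poly → Word → ℚ
coeff [] w = 0ℚ
coeff ((q , u) ∷ f) w with u ≟W w
... | yes _ = q + coeff f w
... | no _ = coeff f w

coeff⊗ : Tensor → Word → Word → ℚ
coeff⊗ [] u v = 0ℚ
coeff⊗ ((q , u' , v') ∷ t) u v with u' ≟W u | v' ≟W v
... | yes _ | yes _ = q + coeff⊗ t u v
... | _ | _ = coeff⊗ t u v

data IsBlockWord : Word → Set where
  empty : IsBlockWord []
  blk2  : ∀ {w} → IsBlockWord w → IsBlockWord (x₀ ∷ x₁ ∷ w)
  blk3  : ∀ {w} → IsBlockWord w → IsBlockWord (x₀ ∷ x₀ ∷ x₁ ∷ w)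

InB23 : Poly → Set
InB23 f = ∀ w → ¬ (coeff f w ≡ 0ℚ) → IsBlockWord w

InQX⊗B23 : Tensor → Set
InQX⊗B23 t = ∀ u v → ¬ (coeff⊗ t u v ≡ 0ℚ) → IsBlockWord v

_⧢w_ : Word → Word → Poly
[] ⧢w v = [ (1ℚ , v) ]
(a ∷ u) ⧢w [] = [ (1ℚ , a ∷ u) ]
(a ∷ u) ⧢w (b ∷ v) =
  map (λ { (q , w) → (q , a ∷ w) }) (u ⧢w (b ∷ v)) ++
  map (λ { (q , w) → (q , b ∷ w) }) ((a ∷ u) ⧢w v)

_⧢_ : Poly → Poly → Poly
f ⧢ g = concatMap (λ { (p , u) → concatMap (λ { (q , v) →
          map (λ { (r , w) → (p * q * r , w) }) (u ⧢w v) }) g }) f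

sign : ℕ → ℚ
sign zero = 1ℚ
sign (suc n) = - sign n

S : Word → Poly
S w = [ (sign (length w) , reverse w) ]

I : Letter → Word → Letter → Poly
I x₁ f x₀ = [ (1ℚ , f) ]
I x₀ f x₁ = S f
I x₀ [] x₀ = [ (1ℚ , []) ]
I x₀ (_ ∷ _) x₀ = []
I x₁ [] x₁ = [ (1ℚ , []) ]
I x₁ (_ ∷ _) x₁ = []

-- Walk over ε₁⋯εₙ choosing the cut positions i₁<…<iₖ.
-- a   : current left endpoint ε_{i_p}
-- seg : letters collected since ε_{i_p}
-- accL: shuffle of the finished factors I(…)
-- accR: ε_{i₁}⋯ε_{i_p}
go : Letter → Word → Poly → Word → Word → Tensor
go a seg accL accR [] =
  map (λ { (q , u) → (q , u , accR) }) (accL ⧢ I a seg x₀)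
go a seg accL accR (c ∷ rest) =
  go a (seg ++ [ c ]) accL accR rest ++
  go c [] (accL ⧢ I a seg c) (accR ++ [ c ]) rest

-- Goncharov coproduct on a word (ε₀ = x₁, ε_{n+1} = x₀)
ΔGonWord : Word → Tensor
ΔGonWord w = go x₁ [] [ (1ℚ , []) ] [] w

ΔGon : Poly → Tensor
ΔGon f = concatMap (λ { (p , w) → map (λ { (q , u , v) → (p * q , u , v) }) (ΔGonWord w) }) f

-- In Δ_Gon(w) the factor I(ε_{i_p}; ⋯; ε_{i_{p+1}}) vanishes when the two cut letters are
-- equal and not adjacent in w.  In a block word two x₁ are never adjacent, at most two x₀
-- are, and the last letter is x₁ (so the final cut is never an x₀ next to ε_{n+1} = x₀).
-- Hence every surviving right factor ε_{i₁}⋯ε_{i_k} avoids x₁x₁ and x₀x₀x₀, starts with x₀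
-- and ends with x₁: it is again a block word.  The coefficient of u ⊗ v in Δ_Gon f
-- depends only on the coefficients of f, so linearity extends this to all of B_{2,3}.

module Submission where

open import Defs
open import Data.Rational using (ℚ; 0ℚ; _+_; _*_)
import Data.Rational.Properties as ℚ
open import Data.Rational.Solver using (module +-*-Solver)
open import Data.List using ([]; _∷_; _++_; [_]; map; length)
open import Data.List.Properties using (++-assoc)
open import Data.List.Relation.Unary.All using (All; []; _∷_)
open import Data.List.Relation.Unary.All.Properties using (++⁺)
open import Data.Product using (_×_; _,_)
open import Data.Nat using (suc; _≤_; z≤n; s≤s)
open import Data.Nat.Properties using (≤-refl; ≤-trans; m≤n⇒m≤1+n)
open import Data.Empty using (⊥-elim)
open import Relation.Nullary using (yes; no; ¬_; Dec)
open import Relation.Binary.PropositionalEquality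
  using (_≡_; _≢_; refl; sym; trans; cong; cong₂; subst; module ≡-Reasoning)

isBlockWord? : (w : Word) → Dec (IsBlockWord w)
isBlockWord? [] = yes empty
isBlockWord? (x₀ ∷ x₁ ∷ w) with isBlockWord? w
... | yes b = yes (blk2 b)
... | no ¬b = no λ { (blk2 b) → ¬b b }
isBlockWord? (x₀ ∷ x₀ ∷ x₁ ∷ w) with isBlockWord? w
... | yes b = yes (blk3 b)
... | no ¬b = no λ { (blk3 b) → ¬b b }
isBlockWord? (x₀ ∷ x₀ ∷ x₀ ∷ w) = no λ ()
isBlockWord? (x₀ ∷ x₀ ∷ []) = no λ ()
isBlockWord? (x₀ ∷ []) = no λ ()
isBlockWord? (x₁ ∷ w) = no λ ()

++-isBlockWord : ∀ {u v} → IsBlockWord u → IsBlockWord v → IsBlockWord (u ++ v)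
++-isBlockWord empty    bv = bv
++-isBlockWord (blk2 b) bv = blk2 (++-isBlockWord b bv)
++-isBlockWord (blk3 b) bv = blk3 (++-isBlockWord b bv)

data Open : Word → Set where
  open₂ : ∀ {B} → IsBlockWord B → Open (B ++ [ x₀ ])
  open₃ : ∀ {B} → IsBlockWord B → Open ((B ++ [ x₀ ]) ++ [ x₀ ])

Open-close : ∀ {A} → Open A → IsBlockWord (A ++ [ x₁ ])
Open-close (open₂ {B} b) =
  subst IsBlockWord (sym (++-assoc B [ x₀ ] [ x₁ ])) (++-isBlockWord b (blk2 empty))
Open-close (open₃ {B} b) =
  subst IsBlockWord (sym (trans (++-assoc (B ++ [ x₀ ]) [ x₀ ] [ x₁ ]) (++-assoc B [ x₀ ] _)))
        (++-isBlockWord b (blk3 empty))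

data BlockSuffix : Word → Set where
  whole : ∀ {r} → IsBlockWord r → BlockSuffix r
  x₁∷_  : ∀ {r} → IsBlockWord r → BlockSuffix (x₁ ∷ r)
  x₀x₁∷_ : ∀ {r} → IsBlockWord r → BlockSuffix (x₀ ∷ x₁ ∷ r)

BlockSuffix-tail : ∀ {c r} → BlockSuffix (c ∷ r) → BlockSuffix r
BlockSuffix-tail (whole (blk2 b)) = x₁∷ b
BlockSuffix-tail (whole (blk3 b)) = x₀x₁∷ b
BlockSuffix-tail (x₁∷ b)          = whole b
BlockSuffix-tail (x₀x₁∷ b)        = x₁∷ b

⧢-zeroʳ : (f : Poly) → f ⧢ [] ≡ []
⧢-zeroʳ []      = refl
⧢-zeroʳ (_ ∷ f) = ⧢-zeroʳ f

go-zeroˡ : ∀ a seg accR rest → go a seg [] accR rest ≡ []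
go-zeroˡ a seg accR [] = refl
go-zeroˡ a seg accR (c ∷ rest)
  rewrite go-zeroˡ a (seg ++ [ c ]) accR rest | go-zeroˡ c [] (accR ++ [ c ]) rest = refl

I-nonempty-equal-ends : ∀ a s ss → I a (s ∷ ss) a ≡ []
I-nonempty-equal-ends x₀ s ss = refl
I-nonempty-equal-ends x₁ s ss = refl

RightBlock : ℚ × Word × Word → Set
RightBlock (_ , _ , v) = IsBlockWord v

cut-repeated : ∀ a s ss accL accR rest →
  All RightBlock (go a [] (accL ⧢ I a (s ∷ ss) a) accR rest)
cut-repeated a s ss accL accR rest
  rewrite I-nonempty-equal-ends a s ss | ⧢-zeroʳ accL | go-zeroˡ a [] accR rest = []

All-RightBlock-map : ∀ {v} → IsBlockWord v → (t : Poly) →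
  All RightBlock (map (λ { (q , u) → (q , u , v) }) t)
All-RightBlock-map b []      = []
All-RightBlock-map b (_ ∷ t) = b ∷ All-RightBlock-map b t

data State : Letter → Word → Word → Word → Set where
  after-x₁       : ∀ {B r} → IsBlockWord B → IsBlockWord r → State x₁ [] B r
  skipping-x₁    : ∀ {B r} s ss → IsBlockWord B → BlockSuffix r → State x₁ (s ∷ ss) B r
  after-x₀       : ∀ {A r} → Open A → IsBlockWord r → State x₀ [] A (x₁ ∷ r)
  after-first-x₀ : ∀ {B r} → IsBlockWord B → IsBlockWord r →
                   State x₀ [] (B ++ [ x₀ ]) (x₀ ∷ x₁ ∷ r)
  skipping-x₀    : ∀ {A r} s ss → Open A → BlockSuffix r → State x₀ (s ∷ ss) A r

mutual
  go-RightBlock : ∀ {a seg accR rest} → State a seg accR rest → ∀ accL →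
                  All RightBlock (go a seg accL accR rest)
  go-RightBlock {rest = []} (after-x₁ b _) accL = All-RightBlock-map b _
  go-RightBlock {rest = []} (skipping-x₁ _ _ b _) accL = All-RightBlock-map b _
  go-RightBlock {rest = []} (skipping-x₀ _ _ _ _) accL
    rewrite ⧢-zeroʳ accL = []
  go-RightBlock {rest = x₀ ∷ _} (after-x₁ b r) accL =
    ++⁺ (go-RightBlock (skipping-x₁ x₀ [] b (BlockSuffix-tail (whole r))) accL)
        (cut-x₀-after-x₁ b (whole r) _)
  go-RightBlock {rest = x₀ ∷ _} (skipping-x₁ s ss b r) accL =
    ++⁺ (go-RightBlock (skipping-x₁ s (ss ++ [ x₀ ]) b (BlockSuffix-tail r)) accL)
        (cut-x₀-after-x₁ b r _)
  go-RightBlock {accR = B} {rest = x₁ ∷ rest} (skipping-x₁ s ss b r) accL =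
    ++⁺ (go-RightBlock (skipping-x₁ s (ss ++ [ x₁ ]) b (BlockSuffix-tail r)) accL)
        (cut-repeated x₁ s ss accL (B ++ [ x₁ ]) rest)
  go-RightBlock {rest = x₁ ∷ _} (after-x₀ o r) accL =
    ++⁺ (go-RightBlock (skipping-x₀ x₁ [] o (whole r)) accL)
        (go-RightBlock (after-x₁ (Open-close o) r) _)
  go-RightBlock {rest = x₀ ∷ x₁ ∷ _} (after-first-x₀ b r) accL =
    ++⁺ (go-RightBlock (skipping-x₀ x₀ [] (open₂ b) (x₁∷ r)) accL)
        (go-RightBlock (after-x₀ (open₃ b) r) _)
  go-RightBlock {accR = A} {rest = x₀ ∷ rest} (skipping-x₀ s ss o r) accL =
    ++⁺ (go-RightBlock (skipping-x₀ s (ss ++ [ x₀ ]) o (BlockSuffix-tail r)) accL)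
        (cut-repeated x₀ s ss accL (A ++ [ x₀ ]) rest)
  go-RightBlock {rest = x₁ ∷ _} (skipping-x₀ s ss o (x₁∷ r)) accL =
    ++⁺ (go-RightBlock (skipping-x₀ s (ss ++ [ x₁ ]) o (whole r)) accL)
        (go-RightBlock (after-x₁ (Open-close o) r) _)

  cut-x₀-after-x₁ : ∀ {B r} → IsBlockWord B → BlockSuffix (x₀ ∷ r) → ∀ accL →
                    All RightBlock (go x₀ [] accL (B ++ [ x₀ ]) r)
  cut-x₀-after-x₁ b (whole (blk2 r)) accL = go-RightBlock (after-x₀ (open₂ b) r) accL
  cut-x₀-after-x₁ b (whole (blk3 r)) accL = go-RightBlock (after-first-x₀ b r) accL
  cut-x₀-after-x₁ b (x₀x₁∷ r)        accL = go-RightBlock (after-x₀ (open₂ b) r) accL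

ΔGonWord-RightBlock : ∀ {w} → IsBlockWord w → All RightBlock (ΔGonWord w)
ΔGonWord-RightBlock b = go-RightBlock (after-x₁ empty b) _

coeff⊗-RightBlock : ∀ (t : Tensor) u {v} → All RightBlock t → ¬ IsBlockWord v →
                    coeff⊗ t u v ≡ 0ℚ
coeff⊗-RightBlock [] u _ _ = refl
coeff⊗-RightBlock ((_ , u′ , v′) ∷ t) u {v} (b ∷ bs) ¬b with u′ ≟W u | v′ ≟W v
... | yes _ | yes refl = ⊥-elim (¬b b)
... | yes _ | no _     = coeff⊗-RightBlock t u bs ¬b
... | no _  | _        = coeff⊗-RightBlock t u bs ¬b

pairing : (Word → ℚ) → Poly → ℚ
pairing φ []            = 0ℚ
pairing φ ((p , w) ∷ f) = p * φ w + pairing φ f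

coeff⊗-++ : ∀ (s t : Tensor) u v → coeff⊗ (s ++ t) u v ≡ coeff⊗ s u v + coeff⊗ t u v
coeff⊗-++ [] t u v = sym (ℚ.+-identityˡ _)
coeff⊗-++ ((q , u′ , v′) ∷ s) t u v with u′ ≟W u | v′ ≟W v
... | yes _ | yes _ = trans (cong (q +_) (coeff⊗-++ s t u v)) (sym (ℚ.+-assoc q _ _))
... | yes _ | no _  = coeff⊗-++ s t u v
... | no _  | _     = coeff⊗-++ s t u v

coeff⊗-scale : ∀ p (t : Tensor) u v →
  coeff⊗ (map (λ { (q , u′ , v′) → (p * q , u′ , v′) }) t) u v ≡ p * coeff⊗ t u v
coeff⊗-scale p [] u v = sym (ℚ.*-zeroʳ p)
coeff⊗-scale p ((q , u′ , v′) ∷ t) u v with u′ ≟W u | v′ ≟W v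
... | yes _ | yes _ =
  trans (cong (p * q +_) (coeff⊗-scale p t u v)) (sym (ℚ.*-distribˡ-+ p q _))
... | yes _ | no _  = coeff⊗-scale p t u v
... | no _  | _     = coeff⊗-scale p t u v

coeff⊗-ΔGon : ∀ f u v → coeff⊗ (ΔGon f) u v ≡ pairing (λ w → coeff⊗ (ΔGonWord w) u v) f
coeff⊗-ΔGon [] u v = refl
coeff⊗-ΔGon ((p , w) ∷ f) u v = begin
  coeff⊗ (scaled ++ ΔGon f) u v
    ≡⟨ coeff⊗-++ scaled (ΔGon f) u v ⟩
  coeff⊗ scaled u v + coeff⊗ (ΔGon f) u v
    ≡⟨ cong₂ _+_ (coeff⊗-scale p (ΔGonWord w) u v) (coeff⊗-ΔGon f u v) ⟩
  p * coeff⊗ (ΔGonWord w) u v + pairing _ f ∎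
  where
  open ≡-Reasoning
  scaled : Tensor
  scaled = map (λ { (q , u′ , v′) → (p * q , u′ , v′) }) (ΔGonWord w)

without : Word → Poly → Poly
without w₀ [] = []
without w₀ ((p , w) ∷ f) with w ≟W w₀
... | yes _ = without w₀ f
... | no _  = (p , w) ∷ without w₀ f

length-without : ∀ w₀ f → length (without w₀ f) ≤ length f
length-without w₀ [] = z≤n
length-without w₀ ((p , w) ∷ f) with w ≟W w₀
... | yes _ = m≤n⇒m≤1+n (length-without w₀ f)
... | no _  = s≤s (length-without w₀ f)

coeff-without-≡ : ∀ w₀ f → coeff (without w₀ f) w₀ ≡ 0ℚ
coeff-without-≡ w₀ [] = refl
coeff-without-≡ w₀ ((p , w) ∷ f) with w ≟W w₀
... | yes _ = coeff-without-≡ w₀ f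
... | no w≢w₀ with w ≟W w₀
...   | yes w≡w₀ = ⊥-elim (w≢w₀ w≡w₀)
...   | no _      = coeff-without-≡ w₀ f

coeff-without-≢ : ∀ w₀ f {w′} → w′ ≢ w₀ → coeff (without w₀ f) w′ ≡ coeff f w′
coeff-without-≢ w₀ [] _ = refl
coeff-without-≢ w₀ ((p , w) ∷ f) {w′} w′≢w₀ with w ≟W w₀
... | yes refl with w ≟W w′
...   | yes refl = ⊥-elim (w′≢w₀ refl)
...   | no _     = coeff-without-≢ w₀ f w′≢w₀
coeff-without-≢ w₀ ((p , w) ∷ f) {w′} w′≢w₀ | no _ with w ≟W w′
...   | yes _ = cong (p +_) (coeff-without-≢ w₀ f w′≢w₀)
...   | no _  = coeff-without-≢ w₀ f w′≢w₀

pairing-without : ∀ φ w₀ f → pairing φ f ≡ coeff f w₀ * φ w₀ + pairing φ (without w₀ f)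
pairing-without φ w₀ [] = solve 1 (λ x → con 0ℚ := con 0ℚ :* x :+ con 0ℚ) refl (φ w₀)
  where open +-*-Solver
pairing-without φ w₀ ((p , w) ∷ f) with w ≟W w₀
... | yes refl = begin
  p * φ w + pairing φ f
    ≡⟨ cong (p * φ w +_) (pairing-without φ w f) ⟩
  p * φ w + (coeff f w * φ w + pairing φ (without w f))
    ≡⟨ solve 4 (λ p c x r → p :* x :+ (c :* x :+ r) := (p :+ c) :* x :+ r) refl
               p (coeff f w) (φ w) _ ⟩
  (p + coeff f w) * φ w + pairing φ (without w f) ∎
  where open ≡-Reasoning; open +-*-Solver
... | no _ = begin
  p * φ w + pairing φ f
    ≡⟨ cong (p * φ w +_) (pairing-without φ w₀ f) ⟩
  p * φ w + (coeff f w₀ * φ w₀ + pairing φ (without w₀ f))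
    ≡⟨ solve 3 (λ a b r → a :+ (b :+ r) := b :+ (a :+ r)) refl
               (p * φ w) (coeff f w₀ * φ w₀) _ ⟩
  coeff f w₀ * φ w₀ + (p * φ w + pairing φ (without w₀ f)) ∎
  where open ≡-Reasoning; open +-*-Solver

without-cons-self : ∀ p w₀ f → without w₀ ((p , w₀) ∷ f) ≡ without w₀ f
without-cons-self p w₀ f with w₀ ≟W w₀
... | yes _    = refl
... | no w₀≢w₀ = ⊥-elim (w₀≢w₀ refl)

VanishesOnSupport : (Word → ℚ) → Poly → Set
VanishesOnSupport φ f = ∀ w → coeff f w ≢ 0ℚ → φ w ≡ 0ℚ

VanishesOnSupport-without : ∀ φ w₀ f → VanishesOnSupport φ f →
                            VanishesOnSupport φ (without w₀ f)
VanishesOnSupport-without φ w₀ f h w c≢0 with w ≟W w₀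
... | yes refl = ⊥-elim (c≢0 (coeff-without-≡ w f))
... | no w≢w₀  = h w (subst (_≢ 0ℚ) (coeff-without-≢ w₀ f w≢w₀) c≢0)

-- Removes one word of f at a time, so length f bounds the recursion depth.
pairing-vanishes : ∀ φ f → VanishesOnSupport φ f → pairing φ f ≡ 0ℚ
pairing-vanishes φ f = bounded (length f) f ≤-refl
  where
  bounded : ∀ n f → length f ≤ n → VanishesOnSupport φ f → pairing φ f ≡ 0ℚ
  bounded _ [] _ _ = refl
  bounded (suc n) g@((p , w₀) ∷ f) (s≤s |f|≤n) h = begin
    pairing φ g                                    ≡⟨ pairing-without φ w₀ g ⟩
    coeff g w₀ * φ w₀ + pairing φ (without w₀ g)   ≡⟨ cong₂ _+_ leading rest ⟩
    0ℚ + 0ℚ                                        ≡⟨⟩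
    0ℚ                                             ∎
    where
    open ≡-Reasoning
    leading : coeff g w₀ * φ w₀ ≡ 0ℚ
    leading with coeff g w₀ ℚ.≟ 0ℚ
    ... | yes c≡0 = trans (cong (_* φ w₀) c≡0) (ℚ.*-zeroˡ (φ w₀))
    ... | no c≢0  = trans (cong (coeff g w₀ *_) (h w₀ c≢0)) (ℚ.*-zeroʳ (coeff g w₀))
    rest : pairing φ (without w₀ g) ≡ 0ℚ
    rest = bounded n (without w₀ g)
      (subst (λ g′ → length g′ ≤ n) (sym (without-cons-self p w₀ f))
             (≤-trans (length-without w₀ f) |f|≤n))
      (VanishesOnSupport-without φ w₀ g h)

lemma4p3 : (f : Defs.Poly) → InB23 f → InQX⊗B23 (ΔGon f)
lemma4p3 f f∈B u v Δf≢0 with isBlockWord? v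
... | yes v∈B = v∈B
... | no v∉B  = ⊥-elim (Δf≢0 (trans (coeff⊗-ΔGon f u v) (pairing-vanishes _ f vanishes)))
  where
  vanishes : VanishesOnSupport (λ w → coeff⊗ (ΔGonWord w) u v) f
  vanishes w c≢0 = coeff⊗-RightBlock (ΔGonWord w) u (ΔGonWord-RightBlock (f∈B w c≢0)) v∉B
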